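{- Let $L,L'$ be complete lattices, let $S\subseteq\mathrm{FinAdd}_L$ be a $^*$-continuous Kleene algebra, and let $V\subseteq\mathrm{FinAdd}_{L,L'}$ be an $S$-semimodule. If each $f\in S$ is locally $^*$-closed and $\top$-continuous and each $v\in V$ is $\top$-continuous, then $(S,V)$ is a generalized $^*$-continuous Kleene algebra.
   Context: Functions are written on the right and composed left to right: $xf$ is $f$ applied to $x$, $fg$ means "first $f$, then $g$". For complete lattices $L,L'$ (least $\bot$, greatest $\top$), $f:L\to L'$ is finitely additive if $\bot f=\bot$ and $(x\vee y)f=xf\vee yf$. $\mathrm{FinAdd}_{L,L'}$ is the set of such maps, ordered pointwise with pointwise suprema; $\bot$ also denotes the constant map with value $\bot$; $\mathrm{FinAdd}_L=\mathrm{FinAdd}_{L,L}$, an idempotent semiring under $\vee$, composition, $\bot$, $\mathrm{id}$. For $f\in\mathrm{FinAdd}_L$: $f^0=\mathrm{id}$, $f^{n+1}=f^nf$, $f^*=\bigvee_nf^n$. $f\in\mathrm{FinAdd}_{L,L'}$ is $\top$-continuous if $f=\bot$ or for all $X\subseteq L$ with $\bigvee X=\top$, $\bigvee_{x\in X}xf=\top$. $f\in\mathrm{FinAdd}_L$ is locally $^*$-closed if for each $x\in L$ either $xf^*=\top$ or $xf^*=x\vee xf\vee\dots\vee xf^N$ for some $N\ge0$. $S\subseteq\mathrm{FinAdd}_L$ is a $^*$-continuous Kleene algebra if it contains $\bot,\mathrm{id}$, is closed under $\vee$, composition and $^*$, is a Kleene algebra (for $x,y\in S$, $yx^*$ is the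 least $z\in S$ with $z=zx\vee y$ and $x^*y$ the least $z\in S$ with $z=xz\vee y$), and $y(\bigvee_nx^n)=\bigvee_nyx^n$, $(\bigvee_nx^n)y=\bigvee_nx^ny$ for all $x,y\in S$. $V\subseteq\mathrm{FinAdd}_{L,L'}$ is an $S$-semimodule if $\bot\in V$ and $V$ is closed under $\vee$ and under the action $fv=f;v$ for $f\in S$. $(S,V)$ is a generalized $^*$-continuous Kleene algebra if moreover $xy^*v=\bigvee_{n\ge0}xy^nv$ for all $x,y\in S$, $v\in V$ (pointwise supremum). -}

module Defs where

open import Level using (Level; Lift; lift; _⊔_) renaming (suc to lsuc)
open import Data.Nat using (ℕ; zero; suc)
open import Data.Bool using (Bool; true; false)
open import Data.Empty using () renaming (⊥ to Empty)
open import Data.Product using (Σ; _×_; _,_; proj₁; ∃)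
open import Data.Sum using (_⊎_)
open import Relation.Binary.Bundles using (Poset)
open import Relation.Unary using (Pred)

record CompleteLattice (c ℓ₁ ℓ₂ : Level) : Set (lsuc (c ⊔ ℓ₁ ⊔ ℓ₂)) where
  field
    poset : Poset c ℓ₁ ℓ₂
  open Poset poset public
  field
    ⋁       : {I : Set c} → (I → Carrier) → Carrier
    ⋁-ub    : {I : Set c} (f : I → Carrier) (i : I) → f i ≤ ⋁ f
    ⋁-least : {I : Set c} (f : I → Carrier) (y : Carrier) →
              ((i : I) → f i ≤ y) → ⋁ f ≤ y

  ⋁ˢ : Pred Carrier c → Carrier
  ⋁ˢ X = ⋁ {Σ Carrier X} proj₁

  ⋁ₙ : (ℕ → Carrier) → Carrier
  ⋁ₙ f = ⋁ {Lift c ℕ} (λ { (lift n) → f n })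

  bot : Carrier
  bot = ⋁ {Lift c Empty} (λ { (lift ()) })

  top : Carrier
  top = ⋁ {Carrier} (λ x → x)

  _∨_ : Carrier → Carrier → Carrier
  x ∨ y = ⋁ {Lift c Bool} (λ { (lift true) → x ; (lift false) → y })

open CompleteLattice using (Carrier)

module _ {c ℓ₁ ℓ₂ ℓ₁' ℓ₂' : Level}
         (L : CompleteLattice c ℓ₁ ℓ₂) (L' : CompleteLattice c ℓ₁' ℓ₂') where
  private
    module A = CompleteLattice L
    module B = CompleteLattice L'

  -- maps L → L'; x f is written f x in Agda
  Map : Set c
  Map = A.Carrier → B.Carrier

  _≐_ : Map → Map → Set (c ⊔ ℓ₁')
  f ≐ g = ∀ x → f x B.≈ g x

  _⊑_ : Map → Map → Set (c ⊔ ℓ₂')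
  f ⊑ g = ∀ x → f x B.≤ g x

  _∨ᵐ_ : Map → Map → Map
  (f ∨ᵐ g) x = f x B.∨ g x

  botᵐ : Map
  botᵐ _ = B.bot

  ⋁ᵐ : (ℕ → Map) → Map
  ⋁ᵐ fs x = B.⋁ₙ (λ n → fs n x)

  -- finitely additive (maps respect the lattice equality, as functions on
  -- the underlying set do)
  IsFinAdd : Map → Set (c ⊔ ℓ₁ ⊔ ℓ₁')
  IsFinAdd f = (∀ {x y} → x A.≈ y → f x B.≈ f y)
             × (f A.bot B.≈ B.bot)
             × (∀ x y → f (x A.∨ y) B.≈ (f x B.∨ f y))

  TopContinuous : Map → Set (lsuc c ⊔ ℓ₁ ⊔ ℓ₁')
  TopContinuous f =
    (f ≐ botᵐ) ⊎
    ((X : Pred A.Carrier c) → A.⋁ˢ X A.≈ A.top →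
       B.⋁ {Σ A.Carrier X} (λ p → f (proj₁ p)) B.≈ B.top)

_⨾_ : ∀ {a b d} {A : Set a} {B : Set b} {C : Set d} →
      (A → B) → (B → C) → A → C
(f ⨾ g) x = g (f x)
infixl 9 _⨾_

module _ {c ℓ₁ ℓ₂ : Level} (L : CompleteLattice c ℓ₁ ℓ₂) where
  private
    module A = CompleteLattice L

  pow : Map L L → ℕ → Map L L
  pow f zero    = λ x → x
  pow f (suc n) = pow f n ⨾ f

  star : Map L L → Map L L
  star f = ⋁ᵐ L L (pow f)

  powJoin : Map L L → A.Carrier → ℕ → A.Carrier
  powJoin f x zero    = x
  powJoin f x (suc N) = powJoin f x N A.∨ pow f (suc N) x

  LocallyStarClosed : Map L L → Set (c ⊔ ℓ₁)
  LocallyStarClosed f =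
    ∀ x → (star f x A.≈ A.top) ⊎ (∃ λ N → star f x A.≈ powJoin f x N)

  record IsStarContinuousKA {ℓS : Level} (S : Pred (Map L L) ℓS)
         : Set (c ⊔ ℓ₁ ⊔ ℓ₂ ⊔ ℓS) where
    field
      ⊆FinAdd   : ∀ f → S f → IsFinAdd L L f
      ∋bot      : S (botᵐ L L)
      ∋id       : S (λ x → x)
      ∨-closed  : ∀ f g → S f → S g → S (_∨ᵐ_ L L f g)
      ⨾-closed  : ∀ f g → S f → S g → S (f ⨾ g)
      *-closed  : ∀ f → S f → S (star f)
      right-fix   : ∀ x y → S x → S y →
                    _≐_ L L (y ⨾ star x) (_∨ᵐ_ L L ((y ⨾ star x) ⨾ x) y)
      right-least : ∀ x y z → S x → S y → S z →
                    _≐_ L L z (_∨ᵐ_ L L (z ⨾ x) y) → _⊑_ L L (y ⨾ star x) z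
      left-fix    : ∀ x y → S x → S y →
                    _≐_ L L (star x ⨾ y) (_∨ᵐ_ L L (x ⨾ (star x ⨾ y)) y)
      left-least  : ∀ x y z → S x → S y → S z →
                    _≐_ L L z (_∨ᵐ_ L L (x ⨾ z) y) → _⊑_ L L (star x ⨾ y) z
      cont-right : ∀ x y → S x → S y →
                   _≐_ L L (y ⨾ ⋁ᵐ L L (pow x)) (⋁ᵐ L L (λ n → y ⨾ pow x n))
      cont-left  : ∀ x y → S x → S y →
                   _≐_ L L (⋁ᵐ L L (pow x) ⨾ y) (⋁ᵐ L L (λ n → pow x n ⨾ y))

module _ {c ℓ₁ ℓ₂ ℓ₁' ℓ₂' : Level}
         (L : CompleteLattice c ℓ₁ ℓ₂) (L' : CompleteLattice c ℓ₁' ℓ₂') where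

  record IsSemimodule {ℓS ℓV : Level} (S : Pred (Map L L) ℓS)
         (V : Pred (Map L L') ℓV) : Set (c ⊔ ℓ₁ ⊔ ℓ₁' ⊔ ℓS ⊔ ℓV) where
    field
      ⊆FinAdd  : ∀ v → V v → IsFinAdd L L' v
      ∋bot     : V (botᵐ L L')
      ∨-closed : ∀ v w → V v → V w → V (_∨ᵐ_ L L' v w)
      act      : ∀ f v → S f → V v → V (f ⨾ v)

  record IsGeneralizedStarContinuousKA {ℓS ℓV : Level} (S : Pred (Map L L) ℓS)
         (V : Pred (Map L L') ℓV) : Set (c ⊔ ℓ₁ ⊔ ℓ₂ ⊔ ℓ₁' ⊔ ℓS ⊔ ℓV) where
    field
      isKA         : IsStarContinuousKA L S
      isSemimodule : IsSemimodule S V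
      gen-cont     : ∀ x y v → S x → S y → V v →
                     _≐_ L L' (x ⨾ star L y ⨾ v) (⋁ᵐ L L' (λ n → x ⨾ pow L y n ⨾ v))

module Submission where

-- For x, y ∈ S, v ∈ V and a point z, both sides of the
-- generalized *-continuity law evaluated at z are about the y-orbit of w = x z:
-- the left side is  v (⋁ₙ w yⁿ)  and the right side is  ⋁ₙ v (w yⁿ).  So it
-- suffices to show that v commutes with the supremum of every orbit of y.
-- The inequality ⋁ₙ v (w yⁿ) ≤ v (⋁ₙ w yⁿ) holds for any monotone v, and
-- finitely additive maps are monotone.  For the converse we use that y is
-- locally *-closed: either the orbit supremum is a finite partial join
-- w ∨ w y ∨ … ∨ w y^N, which v preserves by finite additivity, or it is ⊤,
-- and then ⊤-continuity of v applied to the set of orbit points gives it.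

open import Defs
open import Level using (Level; lift)
open import Data.Nat using (ℕ; zero; suc)
open import Data.Bool using (true; false)
open import Data.Product using (_×_; _,_; Σ; proj₁; proj₂)
open import Data.Sum using (inj₁; inj₂)
open import Relation.Unary using (Pred)
open import Relation.Binary.PropositionalEquality using (_≡_; refl)

module LatticeFacts {c ℓ₁ ℓ₂ : Level} (L : CompleteLattice c ℓ₁ ℓ₂) where
  open CompleteLattice L renaming (refl to ≤-refl)

  ⋁ₙ-ub : (a : ℕ → Carrier) (n : ℕ) → a n ≤ ⋁ₙ a
  ⋁ₙ-ub a n = ⋁-ub _ (lift n)

  ⋁ₙ-least : (a : ℕ → Carrier) (y : Carrier) → (∀ n → a n ≤ y) → ⋁ₙ a ≤ y
  ⋁ₙ-least a y h = ⋁-least _ y (λ { (lift n) → h n })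

  ∨-ubˡ : ∀ a b → a ≤ a ∨ b
  ∨-ubˡ a b = ⋁-ub _ (lift true)

  ∨-ubʳ : ∀ a b → b ≤ a ∨ b
  ∨-ubʳ a b = ⋁-ub _ (lift false)

  ∨-least : ∀ a b d → a ≤ d → b ≤ d → a ∨ b ≤ d
  ∨-least a b d p q = ⋁-least _ d (λ { (lift true) → p ; (lift false) → q })

  bot-least : ∀ a → bot ≤ a
  bot-least a = ⋁-least _ a (λ { (lift ()) })

  top-greatest : ∀ a → a ≤ top
  top-greatest a = ⋁-ub (λ x → x) a

  ≤⇒∨≈ : ∀ a b → a ≤ b → (a ∨ b) ≈ b
  ≤⇒∨≈ a b p = antisym (∨-least a b b p ≤-refl) (∨-ubʳ a b)

module _ {c ℓ₁ ℓ₂ ℓ₁' ℓ₂' : Level}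
         (L : CompleteLattice c ℓ₁ ℓ₂) (L' : CompleteLattice c ℓ₁' ℓ₂') where
  private
    module A = CompleteLattice L
    module B = CompleteLattice L'
    module LA = LatticeFacts L
    module LB = LatticeFacts L'

  -- Finitely additive maps are monotone: a ≤ b gives v a ≤ v a ∨ v b ≈ v (a ∨ b) ≈ v b.
  finAdd-monotone : (v : Map L L') → IsFinAdd L L' v →
                    ∀ {a b} → a A.≤ b → v a B.≤ v b
  finAdd-monotone v (v-resp , _ , v-∨) {a} {b} a≤b =
    B.trans (LB.∨-ubˡ (v a) (v b))
      (B.reflexive (B.Eq.trans (B.Eq.sym (v-∨ a b)) (v-resp (LA.≤⇒∨≈ a b a≤b))))

  monotone-⋁ₙ : (v : Map L L') → (∀ {a b} → a A.≤ b → v a B.≤ v b) →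
                (a : ℕ → A.Carrier) → B.⋁ₙ (λ n → v (a n)) B.≤ v (A.⋁ₙ a)
  monotone-⋁ₙ v v-mono a = LB.⋁ₙ-least _ _ (λ n → v-mono (LA.⋁ₙ-ub a n))

  -- If a sequence has supremum ⊤, a ⊤-continuous map sends that supremum
  -- below the supremum of the images: ⊤-continuity is applied to the set of
  -- points of the sequence (the case v = ⊥ is immediate).
  topContinuous-⋁ₙ : (v : Map L L') → TopContinuous L L' v →
                     (a : ℕ → A.Carrier) → A.⋁ₙ a A.≈ A.top →
                     v (A.⋁ₙ a) B.≤ B.⋁ₙ (λ n → v (a n))
  topContinuous-⋁ₙ v (inj₁ v≐bot) a _ =
    B.trans (B.reflexive (v≐bot _)) (LB.bot-least _)
  topContinuous-⋁ₙ v (inj₂ v-cont) a ⋁a≈top =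
    B.trans (LB.top-greatest _)
      (B.trans (B.reflexive (B.Eq.sym (v-cont points ⋁points≈top)))
        (B.⋁-least _ _ (λ { (_ , n , refl) → LB.⋁ₙ-ub (λ n → v (a n)) n })))
    where
      points : Pred A.Carrier c
      points p = Σ ℕ (λ n → a n ≡ p)

      ⋁points≈top : A.⋁ˢ points A.≈ A.top
      ⋁points≈top = A.antisym (LA.top-greatest _)
        (A.trans (A.reflexive (A.Eq.sym ⋁a≈top))
          (LA.⋁ₙ-least a _ (λ n → A.⋁-ub proj₁ (a n , n , refl))))

module _ {c ℓ₁ ℓ₂ ℓ₁' ℓ₂' : Level}
         (L : CompleteLattice c ℓ₁ ℓ₂) (L' : CompleteLattice c ℓ₁' ℓ₂')
         (f : Map L L) (v : Map L L') (v-finAdd : IsFinAdd L L' v) where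
  private
    module A = CompleteLattice L
    module B = CompleteLattice L'
    module LB = LatticeFacts L'

  orbitImage : A.Carrier → ℕ → B.Carrier
  orbitImage w n = v (pow L f n w)

  -- By finite additivity, v of a finite partial join of the orbit is the
  -- join of finitely many orbit images, hence below all of them.
  finAdd-powJoin : ∀ w N → v (powJoin L f w N) B.≤ B.⋁ₙ (orbitImage w)
  finAdd-powJoin w zero    = LB.⋁ₙ-ub (orbitImage w) 0
  finAdd-powJoin w (suc N) =
    B.trans (B.reflexive (proj₂ (proj₂ v-finAdd) _ _))
      (LB.∨-least _ _ _ (finAdd-powJoin w N) (LB.⋁ₙ-ub (orbitImage w) (suc N)))

  orbit-⋁-preserved : LocallyStarClosed L f → TopContinuous L L' v →
                      ∀ w → v (star L f w) B.≈ B.⋁ₙ (orbitImage w)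
  orbit-⋁-preserved f-closed v-cont w =
    B.antisym upper (monotone-⋁ₙ L L' v (finAdd-monotone L L' v v-finAdd) (λ n → pow L f n w))
    where
      upper : v (star L f w) B.≤ B.⋁ₙ (orbitImage w)
      upper with f-closed w
      ... | inj₁ w*≈top      = topContinuous-⋁ₙ L L' v v-cont (λ n → pow L f n w) w*≈top
      ... | inj₂ (N , w*≈pj) =
        B.trans (finAdd-monotone L L' v v-finAdd (A.reflexive w*≈pj)) (finAdd-powJoin w N)

mainTheorem6 : {c ℓ₁ ℓ₂ ℓ₁' ℓ₂' ℓS ℓV : Level}
    (L : CompleteLattice c ℓ₁ ℓ₂) (L' : CompleteLattice c ℓ₁' ℓ₂')
    (S : Pred (Map L L) ℓS) (V : Pred (Map L L') ℓV) →
    IsStarContinuousKA L S →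
    IsSemimodule L L' S V →
    (∀ f → S f → LocallyStarClosed L f × TopContinuous L L f) →
    (∀ v → V v → TopContinuous L L' v) →
    IsGeneralizedStarContinuousKA L L' S V
mainTheorem6 L L' S V S-KA V-module S-props V-cont = record
  { isKA         = S-KA
  ; isSemimodule = V-module
  ; gen-cont     = λ x y v _ Sy Vv z →
      orbit-⋁-preserved L L' y v (IsSemimodule.⊆FinAdd V-module v Vv)
        (proj₁ (S-props y Sy)) (V-cont v Vv) (x z)
  }
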